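{- If $n\ge 2$ and $\Gamma_1,\dots,\Gamma_n$ are solvable prime graphs, then $\overline{\times}_{i=1}^{n}\Gamma_i$ is not a minimal prime graph.
   Context: All graphs are finite, simple and undirected; $\overline{G}$ is the complement of $G$. The direct product $G\times H$ has vertex set $V(G)\times V(H)$, with $\{(u,v),(u',v')\}$ an edge iff $\{u,u'\}\in E(G)$ and $\{v,v'\}\in E(H)$. The complementary direct product is $G\,\overline{\times}\,H=\overline{\overline{G}\times\overline{H}}$, iterated as $\overline{\times}_{i=1}^{n}\Gamma_i=(\overline{\times}_{i=1}^{n-1}\Gamma_i)\,\overline{\times}\,\Gamma_n$. A solvable prime graph is a graph isomorphic to the prime graph of a finite solvable group; equivalently (by a known result), a graph whose complement is triangle-free and 3-colorable. A minimal prime graph is a connected graph $\Gamma$ on two or more vertices such that (1) $\overline{\Gamma}$ is triangle-free, (2) $\overline{\Gamma}$ is 3-colorable, and (3) for every edge $e$ of $\Gamma$, the complement of the graph obtained from $\Gamma$ by deleting $e$ is not both triangle-free and 3-colorable. -}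

module Defs where

open import Data.Nat using (ℕ; zero; suc; _*_)
open import Data.Fin using (Fin; remQuot; inject₁; fromℕ; _≟_)

open import Data.Bool using (Bool; true; false; not; _∧_; _∨_)
open import Data.Bool.Properties using (∧-comm)
open import Data.Product using (Σ; ∃; _×_; _,_; proj₁; proj₂)
open import Data.Empty using (⊥)
open import Relation.Nullary using (¬_; yes; no)
open import Relation.Nullary.Decidable using (isYes)
open import Relation.Binary.PropositionalEquality

Adj : ℕ → Set
Adj n = Fin n → Fin n → Bool

_==_ : ∀ {n} → Fin n → Fin n → Bool
u == v = isYes (u ≟ v)

==-sym : ∀ {n} (u v : Fin n) → (u == v) ≡ (v == u)
==-sym u v with u ≟ v | v ≟ u
... | yes _ | yes _ = refl
... | no _  | no _  = refl
... | yes p | no q  = ⊥-elim' (q (sym p))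
  where ⊥-elim' : ⊥ → true ≡ false
        ⊥-elim' ()
... | no p  | yes q = ⊥-elim' (p (sym q))
  where ⊥-elim' : ⊥ → false ≡ true
        ⊥-elim' ()

==-refl : ∀ {n} (u : Fin n) → (u == u) ≡ true
==-refl u with u ≟ u
... | yes _ = refl
... | no p  = ⊥-elim' (p refl)
  where ⊥-elim' : ⊥ → false ≡ true
        ⊥-elim' ()

record Graph : Set where
  field
    size   : ℕ
    adj    : Adj size
    adj-sym    : ∀ u v → adj u v ≡ adj v u
    adj-irrefl : ∀ u → adj u u ≡ false
open Graph public

complAdj : ∀ {n} → Adj n → Adj n
complAdj a u v = not (u == v) ∧ not (a u v)

complement : Graph → Graph
complement G = record
  { size = size G
  ; adj = complAdj (adj G)
  ; adj-sym = λ u v → cong₂ (λ x y → not x ∧ not y) (==-sym u v) (adj-sym G u v)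
  ; adj-irrefl = λ u → cong (λ x → not x ∧ not (adj G u u)) (==-refl u)
  }

directProduct : Graph → Graph → Graph
directProduct G H = record
  { size = size G * size H
  ; adj = λ x y → adj G (p x) (p y) ∧ adj H (q x) (q y)
  ; adj-sym = λ x y → cong₂ _∧_ (adj-sym G (p x) (p y)) (adj-sym H (q x) (q y))
  ; adj-irrefl = λ x → cong (λ b → b ∧ adj H (q x) (q x)) (adj-irrefl G (p x))
  }
  where
  p : Fin (size G * size H) → Fin (size G)
  p x = proj₁ (remQuot {size G} (size H) x)
  q : Fin (size G * size H) → Fin (size H)
  q x = proj₂ (remQuot {size G} (size H) x)

_×̄_ : Graph → Graph → Graph
G ×̄ H = complement (directProduct (complement G) (complement H))

-- Iterated complementary direct product of Γ 0, …, Γ k (k+1 factors),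
-- left-associated: ×̄_{i=1}^{k+1} Γ_i = (×̄_{i=1}^{k} Γ_i) ×̄ Γ_{k+1}.
iterProd : (k : ℕ) → (Fin (suc k) → Graph) → Graph
iterProd zero    Γ = Γ zero
  where open import Data.Fin using (zero)
iterProd (suc k) Γ = iterProd k (λ i → Γ (inject₁ i)) ×̄ Γ (fromℕ (suc k))

TriangleFree : ∀ {n} → Adj n → Set
TriangleFree {n} a =
  ¬ (Σ (Fin n) λ x → Σ (Fin n) λ y → Σ (Fin n) λ z →
       (a x y ≡ true) × (a y z ≡ true) × (a x z ≡ true))

ThreeColorable : ∀ {n} → Adj n → Set
ThreeColorable {n} a =
  Σ (Fin n → Fin 3) λ c → ∀ x y → a x y ≡ true → ¬ (c x ≡ c y)

data Reach {n : ℕ} (a : Adj n) : Fin n → Fin n → Set where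
  here : ∀ {x} → Reach a x x
  step : ∀ {x y z} → a x y ≡ true → Reach a y z → Reach a x z

Connected : ∀ {n} → Adj n → Set
Connected {n} a = ∀ (x y : Fin n) → Reach a x y

-- Solvable prime graph: complement triangle-free and 3-colorable
-- (the known characterisation quoted in the paper's context).
SolvablePrimeGraph : Graph → Set
SolvablePrimeGraph G =
  TriangleFree (complAdj (adj G)) × ThreeColorable (complAdj (adj G))

deleteEdge : ∀ {n} → Adj n → Fin n → Fin n → Adj n
deleteEdge a u v x y = a x y ∧ not ((x == u ∧ y == v) ∨ (x == v ∧ y == u))

MinimalPrimeGraph : Graph → Set
MinimalPrimeGraph G =
  Connected (adj G) ×
  (2 Data.Nat.≤ size G) ×
  TriangleFree (complAdj (adj G)) ×
  ThreeColorable (complAdj (adj G)) ×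
  (∀ u v → adj G u v ≡ true →
     ¬ (TriangleFree (complAdj (deleteEdge (adj G) u v)) ×
        ThreeColorable (complAdj (deleteEdge (adj G) u v))))
  where import Data.Nat

{-# OPTIONS --safe #-}
-- The complement of A ×̄ B is the direct product of the complements, so its second
-- projection is a homomorphism onto the complement of B, which is triangle-free and
-- 3-colourable. If that complement has an edge bb′, then (a , b)(a , b′) is an edge of
-- A ×̄ B whose deletion only adds to the complement an edge mapped onto bb′, so the
-- complement stays triangle-free and 3-colourable. If it has no edge, A ×̄ B is
-- complete, and deleting any edge leaves a complement with a single edge, which maps
-- onto K₂. Either way A ×̄ B is not minimal; the theorem takes B = Γₙ.
module Submission where

open import Defs
open import Data.Nat using (ℕ; suc; _≤_; s≤s)
open import Data.Fin using (Fin; zero; suc; _≟_; remQuot; combine; inject₁; fromℕ)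
open import Data.Fin.Properties using (remQuot-combine; combine-injectiveʳ; any?; inject₁-injective)
open import Data.Bool using (true; false; not; _∧_; if_then_else_)
import Data.Bool as Bool
open import Data.Bool.Properties using (∧-conicalˡ; ∧-conicalʳ)
open import Data.Product using (Σ; _×_; _,_; proj₁; proj₂)
open import Data.Sum using (_⊎_; inj₁; inj₂)
open import Data.Empty using (⊥; ⊥-elim)
open import Function using (_∘_)
open import Relation.Nullary using (¬_; yes; no)
open import Relation.Binary.PropositionalEquality

false≢true : false ≡ true → ⊥
false≢true ()

==⇒≡ : ∀ {n} {x y : Fin n} → (x == y) ≡ true → x ≡ y
==⇒≡ {x = x} {y} e with x ≟ y
... | yes x≡y = x≡y

≢⇒==-false : ∀ {n} {x y : Fin n} → ¬ x ≡ y → (x == y) ≡ false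
≢⇒==-false {x = x} {y} x≢y with x ≟ y
... | yes x≡y = ⊥-elim (x≢y x≡y)
... | no _    = refl

complAdj⇒≢ : ∀ {n} (a : Adj n) {x y} → complAdj a x y ≡ true → ¬ x ≡ y
complAdj⇒≢ a {x} e refl rewrite ==-refl x = false≢true e

complAdj-complAdj : ∀ {n} (a : Adj n) {x y} → complAdj (complAdj a) x y ≡ true → a x y ≡ true
complAdj-complAdj a {x} {y} e with x == y | a x y
... | false | true  = refl
... | false | false = ⊥-elim (false≢true e)
... | true  | _     = ⊥-elim (false≢true e)

adj-of-¬complAdj : (G : Graph) {x y : Fin (size G)} →
  ¬ x ≡ y → ¬ complAdj (adj G) x y ≡ true → adj G x y ≡ true
adj-of-¬complAdj G {x} {y} x≢y ¬e with adj G x y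
... | true  = refl
... | false = ⊥-elim (¬e (cong (λ b → not b ∧ true) (≢⇒==-false x≢y)))

complAdj-deleteEdge : ∀ {n} (a : Adj n) {u v x y} →
  complAdj (deleteEdge a u v) x y ≡ true →
  complAdj a x y ≡ true ⊎ (x ≡ u × y ≡ v) ⊎ (x ≡ v × y ≡ u)
complAdj-deleteEdge a {u} {v} {x} {y} e
  with x == y | a x y | x == u in xu | y == v in yv | x == v in xv | y == u in yu
... | true  | _     | _    | _    | _    | _    = ⊥-elim (false≢true e)
... | false | false | _    | _    | _    | _    = inj₁ refl
... | false | true  | true | true | _    | _    = inj₂ (inj₁ (==⇒≡ xu , ==⇒≡ yv))
... | false | true  | _    | _    | true | true = inj₂ (inj₂ (==⇒≡ xv , ==⇒≡ yu))
... | false | true  | true  | false | false | _     = ⊥-elim (false≢true e)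
... | false | true  | true  | false | true  | false = ⊥-elim (false≢true e)
... | false | true  | false | _     | false | _     = ⊥-elim (false≢true e)
... | false | true  | false | _     | true  | false = ⊥-elim (false≢true e)

Hom : ∀ {m n} → Adj m → Adj n → (Fin m → Fin n) → Set
Hom a b f = ∀ x y → a x y ≡ true → b (f x) (f y) ≡ true

TriangleFree-reflect : ∀ {m n} {a : Adj m} {b : Adj n} {f : Fin m → Fin n} →
  Hom a b f → TriangleFree b → TriangleFree a
TriangleFree-reflect {f = f} hom tf (x , y , z , xy , yz , xz) =
  tf (f x , f y , f z , hom x y xy , hom y z yz , hom x z xz)

ThreeColorable-reflect : ∀ {m n} {a : Adj m} {b : Adj n} {f : Fin m → Fin n} →
  Hom a b f → ThreeColorable b → ThreeColorable a
ThreeColorable-reflect {f = f} hom (c , proper) =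
  c ∘ f , λ x y xy → proper (f x) (f y) (hom x y xy)

Hom-complAdj-deleteEdge : (G H : Graph) {f : Fin (size G) → Fin (size H)} {u v : Fin (size G)} →
  Hom (complAdj (adj G)) (adj H) f → adj H (f u) (f v) ≡ true →
  Hom (complAdj (deleteEdge (adj G) u v)) (adj H) f
Hom-complAdj-deleteEdge G H {f} {u} {v} hom fu-fv x y e with complAdj-deleteEdge (adj G) e
... | inj₁ xy                  = hom x y xy
... | inj₂ (inj₁ (refl , refl)) = fu-fv
... | inj₂ (inj₂ (refl , refl)) = trans (adj-sym H (f v) (f u)) fu-fv

¬minimal-of-Hom : (G H : Graph) → TriangleFree (adj H) → ThreeColorable (adj H) →
  (f : Fin (size G) → Fin (size H)) → Hom (complAdj (adj G)) (adj H) f →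
  (u v : Fin (size G)) → adj G u v ≡ true → adj H (f u) (f v) ≡ true →
  ¬ MinimalPrimeGraph G
¬minimal-of-Hom G H tf col f hom u v uv fu-fv (_ , _ , _ , _ , minimal) =
  minimal u v uv (TriangleFree-reflect hom′ tf , ThreeColorable-reflect hom′ col)
  where
  hom′ : Hom (complAdj (deleteEdge (adj G) u v)) (adj H) f
  hom′ = Hom-complAdj-deleteEdge G H hom fu-fv

edgeless : ℕ → Graph
edgeless n = record
  { size       = n
  ; adj        = λ _ _ → false
  ; adj-sym    = λ _ _ → refl
  ; adj-irrefl = λ _ → refl
  }

K₂ : Graph
K₂ = complement (edgeless 2)

K₂-triangleFree : TriangleFree (adj K₂)
K₂-triangleFree (zero     , zero     , _        , () , _  , _ )
K₂-triangleFree (zero     , suc zero , zero     , _  , _  , ())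
K₂-triangleFree (zero     , suc zero , suc zero , _  , () , _ )
K₂-triangleFree (suc zero , zero     , zero     , _  , () , _ )
K₂-triangleFree (suc zero , zero     , suc zero , _  , _  , ())
K₂-triangleFree (suc zero , suc zero , _        , () , _  , _ )

K₂-threeColorable : ThreeColorable (adj K₂)
K₂-threeColorable = inject₁ , λ i j ij → complAdj⇒≢ _ ij ∘ inject₁-injective

distinctPair : ∀ {n} → 2 ≤ n → Σ (Fin n) λ x → Σ (Fin n) λ y → ¬ x ≡ y
distinctPair (s≤s (s≤s _)) = zero , suc zero , λ ()

module ComplementaryProduct (A B : Graph) where

  fst : Fin (size (A ×̄ B)) → Fin (size A)
  fst x = proj₁ (remQuot {size A} (size B) x)

  snd : Fin (size (A ×̄ B)) → Fin (size B)
  snd x = proj₂ (remQuot {size A} (size B) x)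

  fst-combine : ∀ a b → fst (combine a b) ≡ a
  fst-combine a b = cong proj₁ (remQuot-combine {size A} {size B} a b)

  snd-combine : ∀ a b → snd (combine a b) ≡ b
  snd-combine a b = cong proj₂ (remQuot-combine {size A} {size B} a b)

  complAdj-×̄ : ∀ x y → complAdj (adj (A ×̄ B)) x y ≡ true →
    complAdj (adj A) (fst x) (fst y) ≡ true × complAdj (adj B) (snd x) (snd y) ≡ true
  complAdj-×̄ x y e =
    ∧-conicalˡ _ _ product-edge , ∧-conicalʳ (complAdj (adj A) (fst x) (fst y)) _ product-edge
    where
    product-edge : complAdj (adj A) (fst x) (fst y) ∧ complAdj (adj B) (snd x) (snd y) ≡ true
    product-edge = complAdj-complAdj (adj (directProduct (complement A) (complement B))) e

  snd-Hom : Hom (complAdj (adj (A ×̄ B))) (adj (complement B)) snd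
  snd-Hom x y = proj₂ ∘ complAdj-×̄ x y

  adj-×̄-combine : ∀ a {b b′} → ¬ b ≡ b′ →
    adj (A ×̄ B) (combine {size A} a b) (combine a b′) ≡ true
  adj-×̄-combine a {b} {b′} b≢b′ = adj-of-¬complAdj (A ×̄ B) u≢v λ e →
    complAdj⇒≢ (adj A) (proj₁ (complAdj-×̄ _ _ e)) (trans (fst-combine a b) (sym (fst-combine a b′)))
    where
    u≢v : ¬ combine {size A} a b ≡ combine a b′
    u≢v = b≢b′ ∘ combine-injectiveʳ a b a b′

¬minimal-×̄ : (A B : Graph) → SolvablePrimeGraph B → ¬ MinimalPrimeGraph (A ×̄ B)
¬minimal-×̄ A B (tf , col) minimal@(_ , two , _)
  with distinctPair two | any? (λ b → any? (λ b′ → adj (complement B) b b′ Bool.≟ true))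
... | x , _ , _ | yes (b , b′ , bb′) =
  ¬minimal-of-Hom (A ×̄ B) (complement B) tf col snd snd-Hom u v
    (adj-×̄-combine (fst x) (complAdj⇒≢ (adj B) bb′)) snd-uv minimal
  where
  open ComplementaryProduct A B
  u v : Fin (size (A ×̄ B))
  u = combine {size A} (fst x) b
  v = combine {size A} (fst x) b′
  snd-uv : adj (complement B) (snd u) (snd v) ≡ true
  snd-uv rewrite snd-combine (fst x) b | snd-combine (fst x) b′ = bb′
... | x , y , x≢y | no ¬edge =
  ¬minimal-of-Hom (A ×̄ B) K₂ K₂-triangleFree K₂-threeColorable side
    (λ z w e → ⊥-elim (¬complEdge z w e)) x y
    (adj-of-¬complAdj (A ×̄ B) x≢y (¬complEdge x y)) side-xy minimal
  where
  open ComplementaryProduct A B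
  ¬complEdge : ∀ z w → ¬ complAdj (adj (A ×̄ B)) z w ≡ true
  ¬complEdge z w e = ¬edge (_ , _ , proj₂ (complAdj-×̄ z w e))
  side : Fin (size (A ×̄ B)) → Fin 2
  side z = if z == x then zero else suc zero
  side-xy : adj K₂ (side x) (side y) ≡ true
  side-xy rewrite ==-refl x | ≢⇒==-false (x≢y ∘ sym) = refl

mainTheorem14 : (k : ℕ) (Γ : Fin (suc (suc k)) → Graph) →
    (∀ i → SolvablePrimeGraph (Γ i)) →
    ¬ MinimalPrimeGraph (iterProd (suc k) Γ)
mainTheorem14 k Γ solvable = ¬minimal-×̄ (iterProd k (Γ ∘ inject₁)) (Γ (fromℕ (suc k))) (solvable _)
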